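{- Let $A$ be a subset of $\Delta^{m-1}\times\Delta^{n-1}=\{(e_i,f_j):i\in[m],j\in[n]\}$, let $\mathcal T$ be a triangulation of $A$, and let $\sigma\in\mathcal T$. Then there exists $\tau\in\mathcal T$ such that $\sigma\subseteq\tau$ and, for every $f\in\{f_1,\dots,f_n\}$, if $f$ is adjacent in $G(A)$ to a vertex of $G(\sigma)$, then $f$ is adjacent in $G(\tau)$ to a vertex of $G(\sigma)$.
   Context: $e_1,\dots,e_m$ and $f_1,\dots,f_n$ are the standard bases of $\mathbb R^m$, $\mathbb R^n$. For $C\subseteq\Delta^{m-1}\times\Delta^{n-1}$, $G(C)$ is the minimal subgraph of the complete bipartite graph on vertex set $\{e_1,\dots,e_m\}\cup\{f_1,\dots,f_n\}$ with edge set $\{e_if_j:(e_i,f_j)\in C\}$. A triangulation of $A$ is a collection of affinely independent subsets (simplices) of $A$, closed under faces, whose convex hulls cover $\mathrm{conv}(A)$ and intersect pairwise in convex hulls of common faces. -}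

module Defs where

open import Data.Nat using (ℕ; zero; suc)
open import Data.Fin using (Fin; zero; suc)
open import Data.Bool using (Bool; true; false; _∧_)
open import Data.Product using (Σ; ∃; ∃-syntax; _×_; _,_; proj₁; proj₂)
open import Data.Rational using (ℚ; 0ℚ; 1ℚ; _+_; _*_; _≤_)
open import Relation.Binary.PropositionalEquality using (_≡_)

sumFin : ∀ {k} → (Fin k → ℚ) → ℚ
sumFin {zero}  f = 0ℚ
sumFin {suc k} f = f zero + sumFin (λ i → f (suc i))

-- The point (e_i , f_j) of Δ^{m-1} × Δ^{n-1} is indexed by (i , j).
Idx : ℕ → ℕ → Set
Idx m n = Fin m × Fin n

Subset : ℕ → ℕ → Set
Subset m n = Idx m n → Bool

_∈S_ : ∀ {m n} → Idx m n → Subset m n → Set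
p ∈S S = S p ≡ true

_⊆S_ : ∀ {m n} → Subset m n → Subset m n → Set
S ⊆S T = ∀ p → p ∈S S → p ∈S T

_∩S_ : ∀ {m n} → Subset m n → Subset m n → Subset m n
(S ∩S T) p = S p ∧ T p

-- Points of ℝ^m × ℝ^n, with rational coordinates.
Pt : ℕ → ℕ → Set
Pt m n = (Fin m → ℚ) × (Fin n → ℚ)

Coeffs : ℕ → ℕ → Set
Coeffs m n = Idx m n → ℚ

total : ∀ {m n} → Coeffs m n → ℚ
total {m} {n} μ = sumFin (λ i → sumFin (λ j → μ (i , j)))

-- Σ_{(i,j)} μ(i,j) · (e_i , f_j) : the e-part has i-th coordinate Σ_j μ(i,j),
-- the f-part has j-th coordinate Σ_i μ(i,j).
combo : ∀ {m n} → Coeffs m n → Pt m n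
combo μ = (λ i → sumFin (λ j → μ (i , j))) , (λ j → sumFin (λ i → μ (i , j)))

SupportedIn : ∀ {m n} → Coeffs m n → Subset m n → Set
SupportedIn μ S = ∀ p → S p ≡ false → μ p ≡ 0ℚ

InConv : ∀ {m n} → Pt m n → Subset m n → Set
InConv {m} {n} x S =
  ∃[ μ ] ((∀ p → 0ℚ ≤ μ p) × SupportedIn μ S × total μ ≡ 1ℚ ×
          (∀ i → proj₁ (combo μ) i ≡ proj₁ x i) × (∀ j → proj₂ (combo μ) j ≡ proj₂ x j))

-- S is affinely independent: the only affine dependence supported in S is trivial.
-- (combo is compared pointwise to avoid function extensionality issues.)
AffinelyIndependent : ∀ {m n} → Subset m n → Set
AffinelyIndependent {m} {n} S =
  ∀ (μ : Coeffs m n) → SupportedIn μ S → total μ ≡ 0ℚ →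
    (∀ i → sumFin (λ j → μ (i , j)) ≡ 0ℚ) →
    (∀ j → sumFin (λ i → μ (i , j)) ≡ 0ℚ) →
    ∀ p → μ p ≡ 0ℚ

record IsTriangulation {m n : ℕ} (A : Subset m n) (T : Subset m n → Set) : Set where
  field
    simplex⊆A   : ∀ σ → T σ → σ ⊆S A
    affIndep    : ∀ σ → T σ → AffinelyIndependent σ
    faceClosed  : ∀ σ τ → T σ → τ ⊆S σ → T τ
    covers      : ∀ (x : Pt m n) → InConv x A → ∃[ σ ] (T σ × InConv x σ)
    intersectProperly : ∀ σ τ → T σ → T τ → ∀ (x : Pt m n) →
                  InConv x σ → InConv x τ → InConv x (σ ∩S τ)

-- The graph G(C): edges e_i f_j for (i,j) ∈ C; its vertices are the endpoints of edges.
EdgeOfG : ∀ {m n} → Subset m n → Fin m → Fin n → Set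
EdgeOfG C i j = (i , j) ∈S C

EVertexOfG : ∀ {m n} → Subset m n → Fin m → Set
EVertexOfG C i = ∃[ j ] EdgeOfG C i j

-- f_j is adjacent in G(C) to a vertex of G(D).  (In a bipartite graph the
-- neighbours of f_j are vertices e_i.)
FAdjToVertexOf : ∀ {m n} → Subset m n → Fin n → Subset m n → Set
FAdjToVertexOf C j D = ∃[ i ] (EVertexOfG D i × EdgeOfG C i j)

-- Let P be the set of edges of G(A) at vertices of G(σ) and put ν = K·𝟙σ + 𝟙P for a
-- large K.  The normalised point of ν lies in conv A, hence in conv τ for some τ ∈ T, with
-- coefficients λ.  If f_j is adjacent in G(A) to a vertex of G(σ), then ν is positive
-- somewhere in column f_j, so λ is positive at some (e_i, f_j) ∈ τ, and the row of e_i
-- carries a positive entry of ν: e_i is a vertex of G(σ) adjacent to f_j in G(τ).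
-- For σ ⊆ τ: an affinely independent set is a forest in the bipartite graph, so λ is
-- recovered from its margins by repeatedly peeling leaves.  The margins of λ are
-- proportional to K·(margins of 𝟙σ) + (margins of 𝟙P); the first part is integral and
-- K beats the error of the second part, which at most doubles with each peeled leaf.
-- Hence peeling produces nonnegative coefficients on τ with exactly the margins of 𝟙σ:
-- the barycentre of σ lies in conv τ.  As conv σ ∩ conv τ = conv (σ ∩ τ) and
-- barycentric coordinates on σ are unique, every vertex of σ lies in τ.

module Submission where

open import Defs
open import Data.Nat using (ℕ)
open import Data.Fin using (Fin)
open import Data.Product using (Σ; ∃; ∃-syntax; _×_; _,_)

open import Data.Nat as ℕ using (zero; suc; z≤n; s≤s)
import Data.Nat.Properties as ℕ
open import Data.Fin using (zero; suc; toℕ)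
import Data.Fin.Properties as Fin
open import Data.Bool using (Bool; true; false; _∧_; if_then_else_)
open import Data.Vec.Functional using (removeAt)
open import Data.Bool.Properties using (¬-not) renaming (_≟_ to _≟ᵇ_)
open import Data.Rational
  using (ℚ; 0ℚ; 1ℚ; _+_; _*_; _-_; -_; _≤_; _<_; ∣_∣; 1/_; NonZero; nonNegative; positive)
open import Data.Rational.Properties
open import Data.Rational.Solver using (module +-*-Solver)
open import Data.Product using (proj₁; proj₂; ∃₂)
open import Data.Product.Properties using (≡-dec)
open import Data.Sum using (_⊎_; inj₁; inj₂)
open import Data.Empty using (⊥-elim)
open import Function using (_∘_)
open import Relation.Nullary using (¬_; Dec; yes; no; does; contradiction; _×-dec_; _→-dec_)
open import Relation.Nullary.Decidable using (dec-true; dec-false)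
open import Relation.Binary.PropositionalEquality hiding (J)
open import Algebra.Bundles using (CommutativeRing)
open CommutativeRing +-*-commutativeRing using (semiring; ring)
open import Algebra.Properties.Ring ring using (-‿involutive)
open import Algebra.Properties.Semiring.Sum semiring
  using (sum; sum-cong-≗; ∑-distrib-+; ∑-comm; *-distribˡ-sum)
import Algebra.Properties.CommutativeMonoid.Sum ℕ.+-0-commutativeMonoid as ℕΣ
open import Algebra.Properties.Monoid.Mult +-0-monoid
  using () renaming (_×_ to _×ᵐ_; ×-homo-+ to ×ᵐ-homo-+)

open +-*-Solver using (solve; _:=_; _:+_; _:*_; _:-_; :-_; con)
open ≡-Reasoning

private
  variable
    m n k : ℕ
    x y : ℚ

0≤1 : 0ℚ ≤ 1ℚ
0≤1 = nonNegative⁻¹ 1ℚ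

0<1 : 0ℚ < 1ℚ
0<1 = positive⁻¹ 1ℚ

+-nonNeg : 0ℚ ≤ x → 0ℚ ≤ y → 0ℚ ≤ x + y
+-nonNeg = +-mono-≤

+-pos : 0ℚ < x → 0ℚ ≤ y → 0ℚ < x + y
+-pos = +-mono-<-≤

*-nonNeg : 0ℚ ≤ x → 0ℚ ≤ y → 0ℚ ≤ x * y
*-nonNeg {x} {y} 0≤x 0≤y =
  nonNegative⁻¹ (x * y) {{nonNeg*nonNeg⇒nonNeg x {{nonNegative 0≤x}} y {{nonNegative 0≤y}}}}

*-pos : 0ℚ < x → 0ℚ < y → 0ℚ < x * y
*-pos {x} {y} 0<x 0<y = positive⁻¹ (x * y) {{pos*pos⇒pos x {{positive 0<x}} y {{positive 0<y}}}}

<⇒≱ : x < y → ¬ (y ≤ x)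
<⇒≱ x<y y≤x = <-irrefl refl (<-≤-trans x<y y≤x)

pos⇒≢0 : 0ℚ < x → x ≢ 0ℚ
pos⇒≢0 0<x x≡0 = <-irrefl (sym x≡0) 0<x

p≤∣p∣ : ∀ p → p ≤ ∣ p ∣
p≤∣p∣ p with ∣p∣≡p∨∣p∣≡-p p
... | inj₁ ∣p∣≡p = ≤-reflexive (sym ∣p∣≡p)
... | inj₂ ∣p∣≡-p = ≤-trans p≤0 (0≤∣p∣ p)
  where
    p≤0 : p ≤ 0ℚ
    p≤0 = subst₂ _≤_ (-‿involutive p) refl (neg-antimono-≤ (subst (0ℚ ≤_) ∣p∣≡-p (0≤∣p∣ p)))

sumFin≡sum : (f : Fin k → ℚ) → sumFin f ≡ sum f
sumFin≡sum {zero}  f = refl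
sumFin≡sum {suc k} f = cong (f zero +_) (sumFin≡sum (f ∘ suc))

sumFin-cong : {f g : Fin k → ℚ} → (∀ i → f i ≡ g i) → sumFin f ≡ sumFin g
sumFin-cong {zero}  f≗g = refl
sumFin-cong {suc k} f≗g = cong₂ _+_ (f≗g zero) (sumFin-cong (f≗g ∘ suc))

sumFin-zero : {f : Fin k → ℚ} → (∀ i → f i ≡ 0ℚ) → sumFin f ≡ 0ℚ
sumFin-zero {zero}  f≗0 = refl
sumFin-zero {suc k} f≗0 = cong₂ _+_ (f≗0 zero) (sumFin-zero (f≗0 ∘ suc))

sumFin-distrib-+ : (f g : Fin k → ℚ) → sumFin (λ i → f i + g i) ≡ sumFin f + sumFin g
sumFin-distrib-+ f g = begin
  sumFin (λ i → f i + g i) ≡⟨ sumFin≡sum (λ i → f i + g i) ⟩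
  sum (λ i → f i + g i)    ≡⟨ ∑-distrib-+ f g ⟩
  sum f + sum g            ≡⟨ sym (cong₂ _+_ (sumFin≡sum f) (sumFin≡sum g)) ⟩
  sumFin f + sumFin g      ∎

sumFin-distrib-- : (f g : Fin k → ℚ) → sumFin (λ i → f i - g i) ≡ sumFin f - sumFin g
sumFin-distrib-- f g = begin
  Σf-g                                        ≡⟨ solve 2 (λ x y → x := x :+ y :- y) refl Σf-g (sumFin g) ⟩
  Σf-g + sumFin g - sumFin g                  ≡⟨ cong (_- sumFin g) (sumFin-distrib-+ f-g g) ⟨
  sumFin (λ i → (f i - g i) + g i) - sumFin g ≡⟨ cong (_- sumFin g) (sumFin-cong f-g+g≡f) ⟩
  sumFin f - sumFin g                         ∎
  where
    f-g = λ i → f i - g i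
    Σf-g = sumFin f-g
    f-g+g≡f : ∀ i → (f i - g i) + g i ≡ f i
    f-g+g≡f i = solve 2 (λ x y → (x :- y) :+ y := x) refl (f i) (g i)

*-distribˡ-sumFin : (c : ℚ) (f : Fin k → ℚ) → sumFin (λ i → c * f i) ≡ c * sumFin f
*-distribˡ-sumFin c f = begin
  sumFin (λ i → c * f i) ≡⟨ sumFin≡sum (λ i → c * f i) ⟩
  sum (λ i → c * f i)    ≡⟨ sym (*-distribˡ-sum c f) ⟩
  c * sum f              ≡⟨ cong (c *_) (sym (sumFin≡sum f)) ⟩
  c * sumFin f           ∎

sumFin-comm : (f : Fin m → Fin n → ℚ) →
              sumFin (λ i → sumFin (f i)) ≡ sumFin (λ j → sumFin (λ i → f i j))
sumFin-comm f = begin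
  sumFin (λ i → sumFin (f i))           ≡⟨ sumFin≡sum (λ i → sumFin (f i)) ⟩
  sum (λ i → sumFin (f i))              ≡⟨ sum-cong-≗ (λ i → sumFin≡sum (f i)) ⟩
  sum (λ i → sum (f i))                 ≡⟨ ∑-comm f ⟩
  sum (λ j → sum (λ i → f i j))         ≡⟨ sum-cong-≗ (λ j → sumFin≡sum (λ i → f i j)) ⟨
  sum (λ j → sumFin (λ i → f i j))      ≡⟨ sumFin≡sum (λ j → sumFin (λ i → f i j)) ⟨
  sumFin (λ j → sumFin (λ i → f i j))   ∎

sumFin-nonNeg : {f : Fin k → ℚ} → (∀ i → 0ℚ ≤ f i) → 0ℚ ≤ sumFin f
sumFin-nonNeg {zero}  0≤f = ≤-refl
sumFin-nonNeg {suc k} 0≤f = +-nonNeg (0≤f zero) (sumFin-nonNeg (0≤f ∘ suc))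

sumFin-mono-≤ : {f g : Fin k → ℚ} → (∀ i → f i ≤ g i) → sumFin f ≤ sumFin g
sumFin-mono-≤ {zero}  f≤g = ≤-refl
sumFin-mono-≤ {suc k} f≤g = +-mono-≤ (f≤g zero) (sumFin-mono-≤ (f≤g ∘ suc))

≤-sumFin : {f : Fin k → ℚ} → (∀ i → 0ℚ ≤ f i) → ∀ i → f i ≤ sumFin f
≤-sumFin {suc k} {f} 0≤f zero =
  subst (_≤ sumFin f) (+-identityʳ (f zero)) (+-monoʳ-≤ (f zero) (sumFin-nonNeg (0≤f ∘ suc)))
≤-sumFin {suc k} {f} 0≤f (suc i) =
  ≤-trans (≤-sumFin (0≤f ∘ suc) i)
          (subst (_≤ sumFin f) (+-identityˡ _) (+-monoˡ-≤ (sumFin (f ∘ suc)) (0≤f zero)))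

sumFin-pos⇒∃pos : {f : Fin k → ℚ} → 0ℚ < sumFin f → ∃[ i ] 0ℚ < f i
sumFin-pos⇒∃pos {zero} 0<0 = ⊥-elim (<-irrefl refl 0<0)
sumFin-pos⇒∃pos {suc k} {f} 0<Σf with 0ℚ <? f zero
... | yes 0<f₀ = zero , 0<f₀
... | no 0≮f₀ = let i , 0<fᵢ = sumFin-pos⇒∃pos {f = f ∘ suc} 0<Σtail in suc i , 0<fᵢ
  where
    0<Σtail : 0ℚ < sumFin (f ∘ suc)
    0<Σtail with 0ℚ <? sumFin (f ∘ suc)
    ... | yes 0<Σ = 0<Σ
    ... | no 0≮Σ = contradiction (+-mono-≤ (≮⇒≥ 0≮f₀) (≮⇒≥ 0≮Σ)) (<⇒≱ 0<Σf)

sumFin-single : {f : Fin k → ℚ} (a : Fin k) → (∀ i → i ≢ a → f i ≡ 0ℚ) → sumFin f ≡ f a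
sumFin-single {suc k} {f} zero f≡0 =
  trans (cong (f zero +_) (sumFin-zero (λ i → f≡0 (suc i) λ ()))) (+-identityʳ (f zero))
sumFin-single {suc k} {f} (suc a) f≡0 =
  trans (cong₂ _+_ (f≡0 zero λ ()) (sumFin-single a λ i i≢a → f≡0 (suc i) (i≢a ∘ Fin.suc-injective)))
        (+-identityˡ (f (suc a)))

sumFin-telescope : ∀ d (h : ℕ → ℚ) → sumFin {d} (λ r → h (toℕ r) - h (suc (toℕ r))) ≡ h 0 - h d
sumFin-telescope zero    h = sym (+-inverseʳ (h 0))
sumFin-telescope (suc d) h = begin
  (h 0 - h 1) + sumFin {d} (λ r → h (suc (toℕ r)) - h (suc (suc (toℕ r))))
    ≡⟨ cong ((h 0 - h 1) +_) (sumFin-telescope d (h ∘ suc)) ⟩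
  (h 0 - h 1) + (h 1 - h (suc d))
    ≡⟨ solve 3 (λ x y z → (x :- y) :+ (y :- z) := x :- z) refl (h 0) (h 1) (h (suc d)) ⟩
  h 0 - h (suc d) ∎

-- Integrality

𝟙 : Bool → ℚ
𝟙 true  = 1ℚ
𝟙 false = 0ℚ

𝟙-nonNeg : ∀ b → 0ℚ ≤ 𝟙 b
𝟙-nonNeg true  = 0≤1
𝟙-nonNeg false = ≤-refl

∣*𝟙∣≤∣∣ : ∀ p b → ∣ p * 𝟙 b ∣ ≤ ∣ p ∣
∣*𝟙∣≤∣∣ p true  = ≤-reflexive (cong ∣_∣ (*-identityʳ p))
∣*𝟙∣≤∣∣ p false = subst (_≤ ∣ p ∣) (cong ∣_∣ (sym (*-zeroʳ p))) (0≤∣p∣ p)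

ι : ℕ → ℚ
ι a = a ×ᵐ 1ℚ

ι-nonNeg : ∀ a → 0ℚ ≤ ι a
ι-nonNeg zero    = ≤-refl
ι-nonNeg (suc a) = +-nonNeg 0≤1 (ι-nonNeg a)

IsInt : ℚ → Set
IsInt p = ∃₂ λ a b → p ≡ ι a - ι b

IsInt-𝟙 : ∀ b → IsInt (𝟙 b)
IsInt-𝟙 true  = 1 , 0 , refl
IsInt-𝟙 false = 0 , 0 , refl

IsInt-+ : IsInt x → IsInt y → IsInt (x + y)
IsInt-+ (a , b , refl) (c , d , refl) = a ℕ.+ c , b ℕ.+ d , (begin
  (ι a - ι b) + (ι c - ι d)  ≡⟨ solve 4 (λ a b c d → (a :- b) :+ (c :- d) := (a :+ c) :- (b :+ d))
                                       refl (ι a) (ι b) (ι c) (ι d) ⟩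
  (ι a + ι c) - (ι b + ι d)  ≡⟨ cong₂ _-_ (×ᵐ-homo-+ 1ℚ a c) (×ᵐ-homo-+ 1ℚ b d) ⟨
  ι (a ℕ.+ c) - ι (b ℕ.+ d)  ∎)

IsInt-neg : IsInt x → IsInt (- x)
IsInt-neg (a , b , refl) = b , a , solve 2 (λ a b → :- (a :- b) := b :- a) refl (ι a) (ι b)

IsInt-*𝟙 : IsInt x → ∀ b → IsInt (x * 𝟙 b)
IsInt-*𝟙 {x} x-int true  = subst IsInt (sym (*-identityʳ x)) x-int
IsInt-*𝟙 {x} x-int false = 0 , 0 , *-zeroʳ x

IsInt-sumFin : {f : Fin k → ℚ} → (∀ i → IsInt (f i)) → IsInt (sumFin f)
IsInt-sumFin {zero}  _    = 0 , 0 , refl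
IsInt-sumFin {suc k} ints = IsInt-+ (ints zero) (IsInt-sumFin (ints ∘ suc))

IsInt⇒nonNeg⊎≤-1 : IsInt x → 0ℚ ≤ x ⊎ x ≤ - 1ℚ
IsInt⇒nonNeg⊎≤-1 (a , b , refl) with b ℕ.≤? a
... | yes b≤a = let c , b+c≡a = ℕ.m≤n⇒∃[o]m+o≡n b≤a in
  inj₁ (subst (0ℚ ≤_) (begin
    ι c                   ≡⟨ solve 2 (λ x y → y := (x :+ y) :- x) refl (ι b) (ι c) ⟩
    (ι b + ι c) - ι b     ≡⟨ cong (_- ι b) (sym (×ᵐ-homo-+ 1ℚ b c)) ⟩
    ι (b ℕ.+ c) - ι b     ≡⟨ cong (λ x → ι x - ι b) b+c≡a ⟩
    ι a - ι b             ∎) (ι-nonNeg c))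
... | no b≰a = let c , 1+a+c≡b = ℕ.m≤n⇒∃[o]m+o≡n (ℕ.≰⇒> b≰a) in
  inj₂ (subst (_≤ - 1ℚ) (begin
    - 1ℚ - ι c                ≡⟨ solve 2 (λ x y → :- con 1ℚ :- y := x :- (con 1ℚ :+ (x :+ y)))
                                         refl (ι a) (ι c) ⟩
    ι a - (1ℚ + (ι a + ι c))  ≡⟨ cong (λ x → ι a - (1ℚ + x)) (×ᵐ-homo-+ 1ℚ a c) ⟨
    ι a - ι (suc a ℕ.+ c)     ≡⟨ cong (λ x → ι a - ι x) 1+a+c≡b ⟩
    ι a - ι b                 ∎)
    (subst (- 1ℚ - ι c ≤_) (+-identityʳ (- 1ℚ)) (+-monoʳ-≤ (- 1ℚ) (neg-antimono-≤ (ι-nonNeg c)))))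

module _ {K M u w : ℚ} (u-int : IsInt u) (∣w∣≤M : ∣ w ∣ ≤ M) (M<K : M < K) where

  scaled-nonNeg⇒nonNeg : 0ℚ ≤ K * u + w → 0ℚ ≤ u
  scaled-nonNeg⇒nonNeg 0≤Ku+w with IsInt⇒nonNeg⊎≤-1 u-int
  ... | inj₁ 0≤u  = 0≤u
  ... | inj₂ u≤-1 = contradiction 0≤Ku+w (<⇒≱ Ku+w<0)
    where
      0≤K : 0ℚ ≤ K
      0≤K = <⇒≤ (≤-<-trans (≤-trans (0≤∣p∣ w) ∣w∣≤M) M<K)
      Ku+w≤K*-1+M : K * u + w ≤ K * - 1ℚ + M
      Ku+w≤K*-1+M = +-mono-≤ (*-monoˡ-≤-nonNeg K {{nonNegative 0≤K}} u≤-1)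
                             (≤-trans (p≤∣p∣ w) ∣w∣≤M)
      K*-1+M<0 : K * - 1ℚ + M < 0ℚ
      K*-1+M<0 = subst (K * - 1ℚ + M <_) (solve 1 (λ K → K :* (:- con 1ℚ) :+ K := con 0ℚ) refl K)
                       (+-monoʳ-< (K * - 1ℚ) M<K)
      Ku+w<0 : K * u + w < 0ℚ
      Ku+w<0 = ≤-<-trans Ku+w≤K*-1+M K*-1+M<0

scaled-zero⇒zero : ∀ {K M u w} → IsInt u → ∣ w ∣ ≤ M → M < K → K * u + w ≡ 0ℚ → u ≡ 0ℚ
scaled-zero⇒zero {K} {M} {u} {w} u-int ∣w∣≤M M<K Ku+w≡0 = ≤-antisym u≤0 0≤u
  where
    0≤u : 0ℚ ≤ u
    0≤u = scaled-nonNeg⇒nonNeg u-int ∣w∣≤M M<K (≤-reflexive (sym Ku+w≡0))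
    K*-u+-w≡0 : K * - u + - w ≡ 0ℚ
    K*-u+-w≡0 = begin
      K * - u + - w  ≡⟨ solve 3 (λ K u w → K :* (:- u) :+ (:- w) := :- (K :* u :+ w)) refl K u w ⟩
      - (K * u + w)  ≡⟨ cong -_ Ku+w≡0 ⟩
      0ℚ             ∎
    0≤-u : 0ℚ ≤ - u
    0≤-u = scaled-nonNeg⇒nonNeg (IsInt-neg u-int) (subst (_≤ M) (sym (∣-p∣≡∣p∣ w)) ∣w∣≤M) M<K
                        (≤-reflexive (sym K*-u+-w≡0))
    u≤0 : u ≤ 0ℚ
    u≤0 = subst (_≤ 0ℚ) (-‿involutive u) (neg-antimono-≤ 0≤-u)

-- Margins

δ : Fin k → Fin k → ℚ
δ a i = 𝟙 (does (a Fin.≟ i))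

δ-refl : (a : Fin k) → δ a a ≡ 1ℚ
δ-refl a = cong 𝟙 (dec-true (a Fin.≟ a) refl)

δ-≢ : {a i : Fin k} → a ≢ i → δ a i ≡ 0ℚ
δ-≢ {a = a} {i} a≢i = cong 𝟙 (dec-false (a Fin.≟ i) a≢i)

sumFin-δ : (a : Fin k) → sumFin (δ a) ≡ 1ℚ
sumFin-δ a = trans (sumFin-single a (λ i i≢a → δ-≢ (i≢a ∘ sym))) (δ-refl a)

-- A line is a row e_i or a column f_j; margin μ is combo μ with both blocks indexed by lines.
Line : ℕ → ℕ → Set
Line m n = Fin m ⊎ Fin n

margin : Coeffs m n → Line m n → ℚ
margin μ (inj₁ i) = sumFin (λ j → μ (i , j))
margin μ (inj₂ j) = sumFin (λ i → μ (i , j))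

NonNeg : Coeffs m n → Set
NonNeg μ = ∀ p → 0ℚ ≤ μ p

unitAt : Idx m n → Coeffs m n
unitAt (a , b) (i , j) = δ a i * δ b j

incidence : Idx m n → Line m n → Bool
incidence (a , b) (inj₁ i) = does (a Fin.≟ i)
incidence (a , b) (inj₂ j) = does (b Fin.≟ j)

unitAt-self : (q : Idx m n) → unitAt q q ≡ 1ℚ
unitAt-self (a , b) = cong₂ _*_ (δ-refl a) (δ-refl b)

unitAt-≢ : {q p : Idx m n} → q ≢ p → unitAt q p ≡ 0ℚ
unitAt-≢ {q = a , b} {i , j} q≢p with a Fin.≟ i
... | no a≢i    = *-zeroˡ (δ b j)
... | yes refl = trans (*-identityˡ (δ b j)) (δ-≢ (q≢p ∘ cong (a ,_)))

unitAt-nonNeg : (q : Idx m n) → NonNeg (unitAt q)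
unitAt-nonNeg (a , b) (i , j) = *-nonNeg (𝟙-nonNeg (does (a Fin.≟ i))) (𝟙-nonNeg (does (b Fin.≟ j)))

margin-unitAt : (q : Idx m n) → ∀ l → margin (unitAt q) l ≡ 𝟙 (incidence q l)
margin-unitAt (a , b) (inj₁ i) = begin
  sumFin (λ j → δ a i * δ b j) ≡⟨ *-distribˡ-sumFin (δ a i) (δ b) ⟩
  δ a i * sumFin (δ b)         ≡⟨ cong (δ a i *_) (sumFin-δ b) ⟩
  δ a i * 1ℚ                   ≡⟨ *-identityʳ (δ a i) ⟩
  δ a i                        ∎
margin-unitAt (a , b) (inj₂ j) = begin
  sumFin (λ i → δ a i * δ b j) ≡⟨ sumFin-cong (λ i → *-comm (δ a i) (δ b j)) ⟩
  sumFin (λ i → δ b j * δ a i) ≡⟨ *-distribˡ-sumFin (δ b j) (δ a) ⟩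
  δ b j * sumFin (δ a)         ≡⟨ cong (δ b j *_) (sumFin-δ a) ⟩
  δ b j * 1ℚ                   ≡⟨ *-identityʳ (δ b j) ⟩
  δ b j                        ∎

module _ (μ ν : Coeffs m n) where

  margin-+ : ∀ l → margin (λ p → μ p + ν p) l ≡ margin μ l + margin ν l
  margin-+ (inj₁ i) = sumFin-distrib-+ (λ j → μ (i , j)) (λ j → ν (i , j))
  margin-+ (inj₂ j) = sumFin-distrib-+ (λ i → μ (i , j)) (λ i → ν (i , j))

  margin-- : ∀ l → margin (λ p → μ p - ν p) l ≡ margin μ l - margin ν l
  margin-- (inj₁ i) = sumFin-distrib-- (λ j → μ (i , j)) (λ j → ν (i , j))
  margin-- (inj₂ j) = sumFin-distrib-- (λ i → μ (i , j)) (λ i → ν (i , j))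

margin-* : (c : ℚ) (μ : Coeffs m n) → ∀ l → margin (λ p → c * μ p) l ≡ c * margin μ l
margin-* c μ (inj₁ i) = *-distribˡ-sumFin c (λ j → μ (i , j))
margin-* c μ (inj₂ j) = *-distribˡ-sumFin c (λ i → μ (i , j))

margin-sumFin : (μ : Fin k → Coeffs m n) →
                ∀ l → margin (λ p → sumFin (λ r → μ r p)) l ≡ sumFin (λ r → margin (μ r) l)
margin-sumFin μ (inj₁ i) = sumFin-comm (λ j r → μ r (i , j))
margin-sumFin μ (inj₂ j) = sumFin-comm (λ i r → μ r (i , j))

margin-nonNeg : {μ : Coeffs m n} → NonNeg μ → ∀ l → 0ℚ ≤ margin μ l
margin-nonNeg 0≤μ (inj₁ i) = sumFin-nonNeg (λ j → 0≤μ (i , j))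
margin-nonNeg 0≤μ (inj₂ j) = sumFin-nonNeg (λ i → 0≤μ (i , j))

margin≤total : {μ : Coeffs m n} → NonNeg μ → ∀ l → margin μ l ≤ total μ
margin≤total 0≤μ (inj₁ i) = ≤-sumFin (margin-nonNeg 0≤μ ∘ inj₁) i
margin≤total 0≤μ (inj₂ j) = sumFin-mono-≤ (λ i → ≤-sumFin (λ j → 0≤μ (i , j)) j)

margin-zero : {μ : Coeffs m n} → (∀ p → μ p ≡ 0ℚ) → ∀ l → margin μ l ≡ 0ℚ
margin-zero μ≡0 (inj₁ i) = sumFin-zero (λ j → μ≡0 (i , j))
margin-zero μ≡0 (inj₂ j) = sumFin-zero (λ i → μ≡0 (i , j))

margin-int : {μ : Coeffs m n} → (∀ p → IsInt (μ p)) → ∀ l → IsInt (margin μ l)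
margin-int μ-int (inj₁ i) = IsInt-sumFin (λ j → μ-int (i , j))
margin-int μ-int (inj₂ j) = IsInt-sumFin (λ i → μ-int (i , j))

_≟ᴵ_ : (p q : Idx m n) → Dec (p ≡ q)
_≟ᴵ_ = ≡-dec Fin._≟_ Fin._≟_

_─_ : Subset m n → Idx m n → Subset m n
(S ─ q) p = if does (p ≟ᴵ q) then false else S p

module _ {S : Subset m n} {q : Idx m n} where

  ─-self : (S ─ q) q ≡ false
  ─-self rewrite dec-true (q ≟ᴵ q) refl = refl

  ─-other : ∀ {p} → p ≢ q → (S ─ q) p ≡ S p
  ─-other {p} p≢q rewrite dec-false (p ≟ᴵ q) p≢q = refl

  ─-⊆ : (S ─ q) ⊆S S
  ─-⊆ p p∈S─q with p ≟ᴵ q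
  ... | no _ = p∈S─q

nonempty? : (S : Subset m n) → (∃[ p ] p ∈S S) ⊎ (∀ p → S p ≡ false)
nonempty? S with Fin.any? (λ i → Fin.any? (λ j → S (i , j) ≟ᵇ true))
... | yes (i , j , Sij) = inj₁ ((i , j) , Sij)
... | no no-point       = inj₂ (λ (i , j) → ¬-not (λ Sij → no-point (i , j , Sij)))

∧-true⇒ʳ : ∀ {a b} → a ∧ b ≡ true → b ≡ true
∧-true⇒ʳ {true} b≡true = b≡true

⊆⇒false : ∀ {S T : Subset m n} → T ⊆S S → ∀ p → S p ≡ false → T p ≡ false
⊆⇒false T⊆S p Sp≡false = ¬-not λ Tp≡true → contradiction (trans (sym Sp≡false) (T⊆S p Tp≡true)) λ ()

SupportedIn-mono : ∀ {S T : Subset m n} {μ} → T ⊆S S → SupportedIn μ T → SupportedIn μ S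
SupportedIn-mono T⊆S μ-in-T p Sp≡false = μ-in-T p (⊆⇒false T⊆S p Sp≡false)

AffinelyIndependent-anti : ∀ {S T : Subset m n} → T ⊆S S → AffinelyIndependent S → AffinelyIndependent T
AffinelyIndependent-anti T⊆S indep μ μ-in-T = indep μ (SupportedIn-mono T⊆S μ-in-T)

bit : Bool → ℕ
bit true  = 1
bit false = 0

count : Subset m n → ℕ
count S = ℕΣ.sum (λ i → ℕΣ.sum (λ j → bit (S (i , j))))

sumℕ-suc : {f g : Fin k → ℕ} (a : Fin k) → f a ≡ suc (g a) → (∀ i → i ≢ a → f i ≡ g i) →
           ℕΣ.sum f ≡ suc (ℕΣ.sum g)
sumℕ-suc {suc k} {f} {g} a fa≡1+ga f≗g = begin
  ℕΣ.sum f                            ≡⟨ ℕΣ.sum-remove {i = a} f ⟩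
  f a ℕ.+ ℕΣ.sum (removeAt f a)       ≡⟨ cong₂ ℕ._+_ fa≡1+ga
                                                   (ℕΣ.sum-cong-≗ (λ i → f≗g _ (Fin.punchInᵢ≢i a i))) ⟩
  suc (g a ℕ.+ ℕΣ.sum (removeAt g a)) ≡⟨ cong suc (ℕΣ.sum-remove {i = a} g) ⟨
  suc (ℕΣ.sum g)                      ∎

count-─ : ∀ {m n} {S : Subset m n} {q} → S q ≡ true → count S ≡ suc (count (S ─ q))
count-─ {n = n} {S = S} {a , b} Sq≡true =
  sumℕ-suc a (sumℕ-suc b (trans (cong bit Sq≡true) (cong (suc ∘ bit) (sym (─-self {S = S}))))
                         (λ j j≢b → cong bit (sym (─-other {S = S} {p = a , j} (j≢b ∘ cong proj₂)))))
             (λ i i≢a → ℕΣ.sum-cong-≗ {n} λ j →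
                          cong bit (sym (─-other {S = S} {p = i , j} (i≢a ∘ cong proj₁))))

sumℕ-≤ : {f : Fin k → ℕ} {c : ℕ} → (∀ i → f i ℕ.≤ c) → ℕΣ.sum f ℕ.≤ k ℕ.* c
sumℕ-≤ {zero}  f≤c = z≤n
sumℕ-≤ {suc k} f≤c = ℕ.+-mono-≤ (f≤c zero) (sumℕ-≤ (f≤c ∘ suc))

count≤ : (S : Subset m n) → count S ℕ.≤ m ℕ.* n
count≤ {m} {n} S = subst (count S ℕ.≤_) (cong (m ℕ.*_) (ℕ.*-identityʳ n))
                         (sumℕ-≤ (λ i → sumℕ-≤ (λ j → bit≤1 (S (i , j)))))
  where
    bit≤1 : ∀ b → bit b ℕ.≤ 1
    bit≤1 true  = ℕ.≤-refl
    bit≤1 false = z≤n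

-- Leaves of affinely independent sets

InjectiveBelow : {A : Set} → (ℕ → A) → ℕ → Set
InjectiveBelow f l = ∀ {s t} → s ℕ.< t → t ℕ.< l → f s ≢ f t

record FirstRepeat {A : Set} (f : ℕ → A) : Set where
  field
    start  : ℕ
    period : ℕ
    1≤period : 1 ℕ.≤ period
    repeats : f start ≡ f (period ℕ.+ start)
    injective-before : InjectiveBelow f (period ℕ.+ start)

first-repeat : (f : ℕ → Fin m) → FirstRepeat f
first-repeat {m} f = search (suc m) 0 (ℕ.+-identityʳ (suc m)) (λ _ ())
  where
    search : ∀ fuel l → fuel ℕ.+ l ≡ suc m → InjectiveBelow f l → FirstRepeat f
    search zero l refl inj =
      let i , j , i<j , fi≡fj = Fin.pigeonhole (ℕ.n<1+n m) (f ∘ toℕ) in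
      contradiction fi≡fj (inj i<j (Fin.toℕ<n j))
    search (suc fuel) l 1+fuel+l≡1+m inj with ℕ.anyUpTo? (λ s → f s Fin.≟ f l) l
    ... | yes (s , s<l , fs≡fl) = record
      { start = s ; period = l ℕ.∸ s ; 1≤period = ℕ.m<n⇒0<n∸m s<l
      ; repeats = trans fs≡fl (cong f (sym l∸s+s≡l))
      ; injective-before = subst (InjectiveBelow f) (sym l∸s+s≡l) inj }
      where
        l∸s+s≡l : (l ℕ.∸ s) ℕ.+ s ≡ l
        l∸s+s≡l = ℕ.m∸n+n≡m (ℕ.<⇒≤ s<l)
    ... | no no-repeat = search fuel (suc l) (trans (ℕ.+-suc fuel l) 1+fuel+l≡1+m) inj′
      where
        inj′ : InjectiveBelow f (suc l)
        inj′ {s} {t} s<t (s≤s t≤l) with ℕ.m≤n⇒m<n∨m≡n t≤l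
        ... | inj₁ t<l  = inj s<t t<l
        ... | inj₂ refl = λ fs≡ft → no-repeat (s , s<t , fs≡ft)

module _ {a b : ℕ} (R : Fin a → Fin b → Bool) where

  RowLeaf : Set
  RowLeaf = ∃₂ λ i j → R i j ≡ true × (∀ j′ → R i j′ ≡ true → j′ ≡ j)

  RowsBranch : Set
  RowsBranch = ∀ i j → R i j ≡ true → ∃[ j′ ] (j′ ≢ j × R i j′ ≡ true)

  private
    only? : ∀ i j j′ → Dec (R i j′ ≡ true → j′ ≡ j)
    only? i j j′ = (R i j′ ≟ᵇ true) →-dec (j′ Fin.≟ j)

  rowLeaf⊎rowsBranch : RowLeaf ⊎ RowsBranch
  rowLeaf⊎rowsBranch with Fin.any? (λ i → Fin.any? (λ j → (R i j ≟ᵇ true) ×-dec Fin.all? (only? i j)))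
  ... | yes (i , j , Rij , only) = inj₁ (i , j , Rij , only)
  ... | no no-leaf = inj₂ branch
    where
      branch : RowsBranch
      branch i j Rij with Fin.¬∀⟶∃¬ b _ (only? i j) (λ only → no-leaf (i , j , Rij , only))
      ... | j′ , not-only with R i j′ in Rij′ | j′ Fin.≟ j
      ...   | true  | no j′≢j = j′ , j′≢j , Rij′
      ...   | true  | yes refl = contradiction (λ _ → refl) not-only
      ...   | false | _ = contradiction (λ ()) not-only

  sumFin-rowLeaf : (L : Fin a → Fin b → ℚ) → (∀ i j → R i j ≡ false → L i j ≡ 0ℚ) →
                   ((i , j , _) : RowLeaf) → sumFin (L i) ≡ L i j
  sumFin-rowLeaf L L≡0 (i , j , _ , only) =
    sumFin-single j (λ j′ j′≢j → L≡0 i j′ (¬-not (j′≢j ∘ only j′)))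

rows : Subset m n → Fin m → Fin n → Bool
rows S i j = S (i , j)

cols : Subset m n → Fin n → Fin m → Bool
cols S j i = S (i , j)

-- point is the only point of S on line; only the resulting identity of margins is kept.
record Leaf (S : Subset m n) : Set where
  field
    line    : Line m n
    point   : Idx m n
    point∈S : point ∈S S
    margin≡ : ∀ {L} → SupportedIn L S → margin L line ≡ L point

rowLeaf⇒Leaf : {S : Subset m n} → RowLeaf (rows S) → Leaf S
rowLeaf⇒Leaf {S = S} leaf@(i , j , Sij , _) = record
  { line = inj₁ i ; point = i , j ; point∈S = Sij
  ; margin≡ = λ {L} L-in-S → sumFin-rowLeaf (rows S) (λ i j → L (i , j)) (λ i j → L-in-S (i , j)) leaf }

colLeaf⇒Leaf : {S : Subset m n} → RowLeaf (cols S) → Leaf S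
colLeaf⇒Leaf {S = S} leaf@(j , i , Sij , _) = record
  { line = inj₂ j ; point = i , j ; point∈S = Sij
  ; margin≡ = λ {L} L-in-S → sumFin-rowLeaf (cols S) (λ j i → L (i , j)) (λ j i → L-in-S (i , j)) leaf }

unitAt-outside : ∀ {S : Subset m n} {q p} → q ∈S S → S p ≡ false → unitAt q p ≡ 0ℚ
unitAt-outside {q = q} {p} q∈S Sp≡false =
  unitAt-≢ {q = q} {p} λ { refl → contradiction (trans (sym q∈S) Sp≡false) λ () }

-- If every row and every column through a point of S meets S again, alternating column
-- and row steps give an endless walk in S.  Between the first two visits to the same row it
-- runs around a cycle of G(S), whose alternating ±1 edge sum is an affine dependence on S.
module NoBranching {S : Subset m n} (rowsBranch : RowsBranch (rows S)) (colsBranch : RowsBranch (cols S))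
                   (p₀ : Idx m n) (p₀∈S : p₀ ∈S S) where

  Edge : Set
  Edge = Σ (Idx m n) (_∈S S)

  step : Edge → Edge
  step ((i , j) , Sij) =
    let i′ , _ , Si′j = colsBranch j i Sij
        j′ , _ , Si′j′ = rowsBranch i′ j Si′j
    in (i′ , j′) , Si′j′

  walk : ℕ → Edge
  walk zero    = p₀ , p₀∈S
  walk (suc t) = step (walk t)

  I : ℕ → Fin m
  I t = proj₁ (proj₁ (walk t))

  J : ℕ → Fin n
  J t = proj₂ (proj₁ (walk t))

  edge turn : ℕ → Idx m n
  edge t = I t , J t
  turn t = I (suc t) , J t

  edge∈S : ∀ t → edge t ∈S S
  edge∈S t = proj₂ (walk t)

  turn∈S : ∀ t → turn t ∈S S
  turn∈S t = proj₂ (proj₂ (colsBranch (J t) (I t) (edge∈S t)))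

  I-moves : ∀ t → I (suc t) ≢ I t
  I-moves t = proj₁ (proj₂ (colsBranch (J t) (I t) (edge∈S t)))

  J-moves : ∀ t → J (suc t) ≢ J t
  J-moves t = proj₁ (proj₂ (rowsBranch (I (suc t)) (J t) (turn∈S t)))

  module Cycle (k d : ℕ) (closes : I k ≡ I (2 ℕ.+ d ℕ.+ k))
               (open-path : InjectiveBelow I (2 ℕ.+ d ℕ.+ k)) where

    time : Fin (2 ℕ.+ d) → ℕ
    time r = toℕ r ℕ.+ k

    C : Fin (2 ℕ.+ d) → Coeffs m n
    C r p = unitAt (edge (time r)) p - unitAt (turn (time r)) p

    μ : Coeffs m n
    μ p = sumFin (λ r → C r p)

    μ-in-S : SupportedIn μ S
    μ-in-S p Sp≡false = sumFin-zero {2 ℕ.+ d} λ r →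
      cong₂ _-_ (unitAt-outside {S = S} {q = edge (time r)} {p} (edge∈S (time r)) Sp≡false)
                (unitAt-outside {S = S} {q = turn (time r)} {p} (turn∈S (time r)) Sp≡false)

    step-margin : Fin (2 ℕ.+ d) → Line m n → ℚ
    step-margin r l = 𝟙 (incidence (edge (time r)) l) - 𝟙 (incidence (turn (time r)) l)

    margin-C : ∀ r l → margin (C r) l ≡ step-margin r l
    margin-C r l = trans (margin-- (unitAt (edge (time r))) (unitAt (turn (time r))) l)
                         (cong₂ _-_ (margin-unitAt (edge (time r)) l) (margin-unitAt (turn (time r)) l))

    margin-μ : ∀ l → margin μ l ≡ 0ℚ
    margin-μ l = trans (margin-sumFin C l) (trans (sumFin-cong (λ r → margin-C r l)) (telescopes l))
      where
        end = 2 ℕ.+ d ℕ.+ k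
        telescopes : ∀ l → sumFin (λ r → step-margin r l) ≡ 0ℚ
        telescopes (inj₁ i) = begin
          sumFin (λ r → δ (I (time r)) i - δ (I (suc (time r))) i)
            ≡⟨ sumFin-telescope (2 ℕ.+ d) (λ s → δ (I (s ℕ.+ k)) i) ⟩
          δ (I k) i - δ (I end) i    ≡⟨ cong (λ x → δ x i - δ (I end) i) closes ⟩
          δ (I end) i - δ (I end) i  ≡⟨ +-inverseʳ (δ (I end) i) ⟩
          0ℚ                         ∎
        telescopes (inj₂ j) = sumFin-zero (λ r → +-inverseʳ (δ (J (time r)) j))

    away : ∀ t → suc k ℕ.< t → t ℕ.≤ 2 ℕ.+ d ℕ.+ k → I t ≢ I (suc k)
    away t k+1<t t≤end with ℕ.m≤n⇒m<n∨m≡n t≤end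
    ... | inj₁ t<end = open-path k+1<t t<end ∘ sym
    ... | inj₂ refl  = λ It≡Ik+1 → I-moves k (trans (sym It≡Ik+1) (sym closes))

    -- Rows are not revisited before the walk closes, so edge (1 + k) occurs only at step 1.
    μ-at-edge : μ (edge (suc k)) ≡ 1ℚ
    μ-at-edge = trans (sumFin-single (suc zero) off-diagonal) on-diagonal
      where
        on-diagonal : C (suc zero) (edge (suc k)) ≡ 1ℚ
        on-diagonal = begin
          unitAt (edge (suc k)) (edge (suc k)) - unitAt (turn (suc k)) (edge (suc k))
            ≡⟨ cong₂ _-_ (unitAt-self (edge (suc k)))
                         (unitAt-≢ {q = turn (suc k)} (I-moves (suc k) ∘ cong proj₁)) ⟩
          1ℚ - 0ℚ
            ≡⟨ +-identityʳ 1ℚ ⟩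
          1ℚ ∎
        off-diagonal : ∀ r → r ≢ suc zero → C r (edge (suc k)) ≡ 0ℚ
        off-diagonal zero _ =
          cong₂ _-_ (unitAt-≢ {q = edge k} {edge (suc k)} (I-moves k ∘ sym ∘ cong proj₁))
                    (unitAt-≢ {q = turn k} {edge (suc k)} (J-moves k ∘ sym ∘ cong proj₂))
        off-diagonal (suc zero) r≢1 = contradiction refl r≢1
        off-diagonal (suc (suc r)) _ =
          cong₂ _-_ (unitAt-≢ {q = edge t} {edge (suc k)} (away t k+1<t t≤end ∘ cong proj₁))
                    (unitAt-≢ {q = turn t} {edge (suc k)}
                              (away (suc t) (ℕ.m<n⇒m<1+n k+1<t) t+1≤end ∘ cong proj₁))
          where
            t = 2 ℕ.+ toℕ r ℕ.+ k
            k+1<t : suc k ℕ.< t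
            k+1<t = s≤s (s≤s (ℕ.m≤n+m k (toℕ r)))
            t+1≤end : suc t ℕ.≤ 2 ℕ.+ d ℕ.+ k
            t+1≤end = s≤s (s≤s (ℕ.+-monoˡ-< k (Fin.toℕ<n r)))
            t≤end : t ℕ.≤ 2 ℕ.+ d ℕ.+ k
            t≤end = ℕ.<⇒≤ t+1≤end

    not-independent : ¬ AffinelyIndependent S
    not-independent indep = pos⇒≢0 0<1 (trans (sym μ-at-edge) μ-zero)
      where
        μ-zero : μ (edge (suc k)) ≡ 0ℚ
        μ-zero = indep μ μ-in-S (sumFin-zero (margin-μ ∘ inj₁)) (margin-μ ∘ inj₁) (margin-μ ∘ inj₂)
                       (edge (suc k))

  not-independent : ¬ AffinelyIndependent S
  not-independent with first-repeat I
  ... | record { period = zero ; 1≤period = () }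
  ... | record { start = k ; period = suc zero ; repeats = closes } = λ _ → I-moves k (sym closes)
  ... | record { start = k ; period = suc (suc d) ; repeats = closes ; injective-before = open-path } =
    Cycle.not-independent k d closes open-path

independent⇒leaf : ∀ {S : Subset m n} {p} → AffinelyIndependent S → p ∈S S → Leaf S
independent⇒leaf {S = S} {p} indep p∈S with rowLeaf⊎rowsBranch (rows S) | rowLeaf⊎rowsBranch (cols S)
... | inj₁ rowLeaf   | _               = rowLeaf⇒Leaf rowLeaf
... | inj₂ _         | inj₁ colLeaf    = colLeaf⇒Leaf colLeaf
... | inj₂ rowBranch | inj₂ colBranch  =
  contradiction indep (NoBranching.not-independent rowBranch colBranch p p∈S)

-- Rounding on forests

_*2^_ : ℚ → ℕ → ℚ
M *2^ zero  = M
M *2^ suc c = (M + M) *2^ c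

≤*2^ : 0ℚ ≤ x → ∀ c → x ≤ x *2^ c
≤*2^ 0≤x zero    = ≤-refl
≤*2^ {x} 0≤x (suc c) =
  ≤-trans (subst (_≤ x + x) (+-identityʳ x) (+-monoʳ-≤ x 0≤x)) (≤*2^ (+-nonNeg 0≤x 0≤x) c)

Realisable : Subset m n → (Line m n → ℚ) → Set
Realisable {m} {n} S u = ∃[ μ ] (NonNeg μ × SupportedIn μ S × ∀ l → margin μ l ≡ u l)

record ScaledMargins (S : Subset m n) (L : Coeffs m n) (K M : ℚ) (u : Line m n → ℚ) : Set where
  field
    L-nonNeg    : NonNeg L
    L-in-S      : SupportedIn L S
    u-int       : ∀ l → IsInt (u l)
    error       : Line m n → ℚ
    error-bound : ∀ l → ∣ error l ∣ ≤ M
    margin-L    : ∀ l → margin L l ≡ K * u l + error l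

module _ {S : Subset m n} {L K M u} (sm : ScaledMargins S L K M u) (M<K : M < K) where
  open ScaledMargins sm

  realisable-empty : (∀ p → S p ≡ false) → Realisable S u
  realisable-empty S-empty = (λ _ → 0ℚ) , (λ _ → ≤-refl) , (λ _ _ → refl) , u≡0
    where
      u≡0 : ∀ l → margin (λ _ → 0ℚ) l ≡ u l
      u≡0 l = trans (margin-zero (λ _ → refl) l)
                    (sym (scaled-zero⇒zero (u-int l) (error-bound l) M<K
                                     (trans (sym (margin-L l)) (margin-zero (λ p → L-in-S p (S-empty p)) l))))

  module Peel (lf : Leaf S) where
    open Leaf lf renaming (point to q)

    v : ℚ
    v = u line

    Lq≡Kv+error : L q ≡ K * v + error line
    Lq≡Kv+error = trans (sym (margin≡ L-in-S)) (margin-L line)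

    v-nonNeg : 0ℚ ≤ v
    v-nonNeg = scaled-nonNeg⇒nonNeg (u-int line) (error-bound line) M<K
                                    (subst (0ℚ ≤_) Lq≡Kv+error (L-nonNeg q))

    L′ : Coeffs m n
    L′ p = L p - L q * unitAt q p

    L′-self : L′ q ≡ 0ℚ
    L′-self = trans (cong (λ x → L q - L q * x) (unitAt-self q))
                    (solve 1 (λ x → x :- x :* con 1ℚ := con 0ℚ) refl (L q))

    L′-other : ∀ {p} → p ≢ q → L′ p ≡ L p
    L′-other {p} p≢q = trans (cong (λ x → L p - L q * x) (unitAt-≢ {q = q} {p} (p≢q ∘ sym)))
                             (solve 2 (λ x y → x :- y :* con 0ℚ := x) refl (L p) (L q))

    u′ error′ : Line m n → ℚ
    u′ l = u l - v * 𝟙 (incidence q l)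
    error′ l = error l - error line * 𝟙 (incidence q l)

    scaled : ScaledMargins (S ─ q) L′ K (M + M) u′
    scaled = record
      { L-nonNeg = L′-nonNeg
      ; L-in-S = L′-in-S─q
      ; u-int = λ l → IsInt-+ (u-int l) (IsInt-neg (IsInt-*𝟙 (u-int line) (incidence q l)))
      ; error = error′
      ; error-bound = λ l → ≤-trans (∣p-q∣≤∣p∣+∣q∣ (error l) _)
                              (+-mono-≤ (error-bound l)
                                        (≤-trans (∣*𝟙∣≤∣∣ (error line) (incidence q l)) (error-bound line)))
      ; margin-L = margin-L′ }
      where
        L′-nonNeg : NonNeg L′
        L′-nonNeg p with p ≟ᴵ q
        ... | yes refl = ≤-reflexive (sym L′-self)
        ... | no p≢q   = subst (0ℚ ≤_) (sym (L′-other p≢q)) (L-nonNeg p)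
        L′-in-S─q : SupportedIn L′ (S ─ q)
        L′-in-S─q p p∉S─q with p ≟ᴵ q
        ... | yes refl = L′-self
        ... | no p≢q   = trans (L′-other p≢q) (L-in-S p p∉S─q)
        margin-L′ : ∀ l → margin L′ l ≡ K * u′ l + error′ l
        margin-L′ l = begin
          margin L′ l
            ≡⟨ margin-- L (λ p → L q * unitAt q p) l ⟩
          margin L l - margin (λ p → L q * unitAt q p) l
            ≡⟨ cong (λ x → margin L l - x) (trans (margin-* (L q) (unitAt q) l)
                                                   (cong (L q *_) (margin-unitAt q l))) ⟩
          margin L l - L q * 𝟙 (incidence q l)
            ≡⟨ cong₂ (λ x y → x - y * 𝟙 (incidence q l)) (margin-L l) Lq≡Kv+error ⟩
          (K * u l + error l) - (K * v + error line) * 𝟙 (incidence q l)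
            ≡⟨ solve 6 (λ K a b c d e → (K :* a :+ b) :- (K :* c :+ d) :* e
                                        := K :* (a :- c :* e) :+ (b :- d :* e))
                       refl K (u l) (error l) v (error line) (𝟙 (incidence q l)) ⟩
          K * u′ l + error′ l ∎

    extend : Realisable (S ─ q) u′ → Realisable S u
    extend (μ′ , μ′-nonNeg , μ′-in-S─q , margin-μ′) = μ , μ-nonNeg , μ-in-S , margin-μ
      where
        μ : Coeffs m n
        μ p = μ′ p + v * unitAt q p
        μ-nonNeg : NonNeg μ
        μ-nonNeg p = +-nonNeg (μ′-nonNeg p) (*-nonNeg v-nonNeg (unitAt-nonNeg q p))
        μ-in-S : SupportedIn μ S
        μ-in-S p Sp≡false = begin
          μ′ p + v * unitAt q p
            ≡⟨ cong₂ (λ x y → x + v * y) (SupportedIn-mono (─-⊆ {S = S}) μ′-in-S─q p Sp≡false)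
                                        (unitAt-outside {S = S} {q} {p} point∈S Sp≡false) ⟩
          0ℚ + v * 0ℚ
            ≡⟨ solve 1 (λ v → con 0ℚ :+ v :* con 0ℚ := con 0ℚ) refl v ⟩
          0ℚ ∎
        margin-μ : ∀ l → margin μ l ≡ u l
        margin-μ l = begin
          margin μ l
            ≡⟨ margin-+ μ′ (λ p → v * unitAt q p) l ⟩
          margin μ′ l + margin (λ p → v * unitAt q p) l
            ≡⟨ cong₂ _+_ (margin-μ′ l)
                         (trans (margin-* v (unitAt q) l) (cong (v *_) (margin-unitAt q l))) ⟩
          u′ l + v * 𝟙 (incidence q l)
            ≡⟨ solve 2 (λ x y → (x :- y) :+ y := x) refl (u l) (v * 𝟙 (incidence q l)) ⟩
          u l ∎

-- At a leaf q on line l, L q is the margin K·u l + error l, so u l ≥ 0 by integrality.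
-- Removing q with its contribution keeps u integral and at most doubles the error bound;
-- once S is empty, the margins vanish and integrality forces u = 0.
forest-rounding : ∀ c {S : Subset m n} → count S ℕ.≤ c → AffinelyIndependent S →
                  ∀ {L K M u} → 0ℚ ≤ M → M *2^ c < K → ScaledMargins S L K M u → Realisable S u
forest-rounding c {S} count≤c indep {M = M} 0≤M M*2^c<K sm with nonempty? S
... | inj₂ S-empty = realisable-empty sm (≤-<-trans (≤*2^ 0≤M c) M*2^c<K) S-empty
forest-rounding zero {S} count≤0 _ _ _ _ | inj₁ (p , p∈S) =
  contradiction (subst (ℕ._≤ 0) (count-─ {S = S} p∈S) count≤0) λ ()
forest-rounding (suc c) {S} count≤1+c indep {M = M} 0≤M M*2^c<K sm | inj₁ (p , p∈S) =
  extend (forest-rounding c count′≤c (AffinelyIndependent-anti (─-⊆ {S = S}) indep)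
                          (+-nonNeg 0≤M 0≤M) M*2^c<K scaled)
  where
    lf = independent⇒leaf indep p∈S
    open Peel sm (≤-<-trans (≤*2^ 0≤M (suc c)) M*2^c<K) lf
    count′≤c : count (S ─ Leaf.point lf) ℕ.≤ c
    count′≤c = ℕ.≤-pred (subst (ℕ._≤ suc c) (count-─ {S = S} (Leaf.point∈S lf)) count≤1+c)

-- Convex hulls

_≗ᵖ_ : Pt m n → Pt m n → Set
x ≗ᵖ y = (∀ i → proj₁ x i ≡ proj₁ y i) × (∀ j → proj₂ x j ≡ proj₂ y j)

margins⇒≗ᵖ : {μ ν : Coeffs m n} → (∀ l → margin μ l ≡ margin ν l) → combo μ ≗ᵖ combo ν
margins⇒≗ᵖ same = same ∘ inj₁ , same ∘ inj₂

≗ᵖ⇒margins : {μ ν : Coeffs m n} → combo μ ≗ᵖ combo ν → ∀ l → margin μ l ≡ margin ν l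
≗ᵖ⇒margins (same-rows , _) (inj₁ i) = same-rows i
≗ᵖ⇒margins (_ , same-cols) (inj₂ j) = same-cols j

total-same-margins : {μ ν : Coeffs m n} → (∀ l → margin μ l ≡ margin ν l) → total μ ≡ total ν
total-same-margins same = sumFin-cong (same ∘ inj₁)

entry≤total : {μ : Coeffs m n} → NonNeg μ → ∀ p → μ p ≤ total μ
entry≤total μ-nonNeg (i , j) =
  ≤-trans (≤-sumFin (λ j → μ-nonNeg (i , j)) j) (margin≤total μ-nonNeg (inj₁ i))

total-* : (c : ℚ) (μ : Coeffs m n) → total (λ p → c * μ p) ≡ c * total μ
total-* c μ = trans (sumFin-cong (margin-* c μ ∘ inj₁)) (*-distribˡ-sumFin c (margin μ ∘ inj₁))

*-NonNeg : ∀ {c} {μ : Coeffs m n} → 0ℚ ≤ c → NonNeg μ → NonNeg (λ p → c * μ p)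
*-NonNeg 0≤c μ-nonNeg p = *-nonNeg 0≤c (μ-nonNeg p)

*-SupportedIn : ∀ {c} {μ : Coeffs m n} {S} → SupportedIn μ S → SupportedIn (λ p → c * μ p) S
*-SupportedIn {c = c} μ-in-S p Sp≡false = trans (cong (c *_) (μ-in-S p Sp≡false)) (*-zeroʳ c)

module _ (ν : Coeffs m n) (0<total : 0ℚ < total ν) where
  private instance
    total≢0 : NonZero (total ν)
    total≢0 = pos⇒nonZero (total ν) {{positive 0<total}}

  normalise : Coeffs m n
  normalise p = 1/ total ν * ν p

  0<1/total : 0ℚ < 1/ total ν
  0<1/total = positive⁻¹ (1/ total ν) {{1/pos⇒pos (total ν) {{positive 0<total}}}}

  normalise-nonNeg : NonNeg ν → NonNeg normalise
  normalise-nonNeg = *-NonNeg (<⇒≤ 0<1/total)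

  normalise-in : ∀ {S} → SupportedIn ν S → SupportedIn normalise S
  normalise-in = *-SupportedIn {c = 1/ total ν}

  normalise-pos : ∀ {p} → 0ℚ < ν p → 0ℚ < normalise p
  normalise-pos = *-pos 0<1/total

  normalise-zero : ∀ {p} → ν p ≡ 0ℚ → normalise p ≡ 0ℚ
  normalise-zero νp≡0 = trans (cong (1/ total ν *_) νp≡0) (*-zeroʳ (1/ total ν))

  total-normalise : total normalise ≡ 1ℚ
  total-normalise = trans (total-* (1/ total ν) ν) (*-inverseˡ (total ν))

  inConv-normalise : ∀ {S μ} → NonNeg μ → SupportedIn μ S → (∀ l → margin μ l ≡ margin ν l) →
                     InConv (combo normalise) S
  inConv-normalise {S} {μ} μ-nonNeg μ-in-S same =
    μ′ , *-NonNeg (<⇒≤ 0<1/total) μ-nonNeg , *-SupportedIn {c = 1/ total ν} μ-in-S , total-μ′ ,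
    margins⇒≗ᵖ margin-μ′
    where
      μ′ : Coeffs m n
      μ′ p = 1/ total ν * μ p
      margin-μ′ : ∀ l → margin μ′ l ≡ margin normalise l
      margin-μ′ l = begin
        margin μ′ l                 ≡⟨ margin-* (1/ total ν) μ l ⟩
        1/ total ν * margin μ l     ≡⟨ cong (1/ total ν *_) (same l) ⟩
        1/ total ν * margin ν l     ≡⟨ margin-* (1/ total ν) ν l ⟨
        margin normalise l          ∎
      total-μ′ : total μ′ ≡ 1ℚ
      total-μ′ = trans (total-same-margins margin-μ′) total-normalise

  total*margin-normalise : ∀ l → total ν * margin normalise l ≡ margin ν l
  total*margin-normalise l = begin
    total ν * margin normalise l          ≡⟨ cong (total ν *_) (margin-* (1/ total ν) ν l) ⟩
    total ν * (1/ total ν * margin ν l)   ≡⟨ *-assoc (total ν) (1/ total ν) (margin ν l) ⟨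
    total ν * 1/ total ν * margin ν l     ≡⟨ cong (_* margin ν l) (*-inverseʳ (total ν)) ⟩
    1ℚ * margin ν l                       ≡⟨ *-identityˡ (margin ν l) ⟩
    margin ν l                            ∎

unique-coefficients : ∀ {S : Subset m n} {α β} → AffinelyIndependent S → SupportedIn α S → SupportedIn β S →
                      (∀ l → margin α l ≡ margin β l) → ∀ p → α p ≡ β p
unique-coefficients {α = α} {β} indep α-in-S β-in-S same p = begin
  α p                ≡⟨ solve 2 (λ a b → a := (a :- b) :+ b) refl (α p) (β p) ⟩
  (α p - β p) + β p  ≡⟨ cong (_+ β p) γ≡0 ⟩
  0ℚ + β p           ≡⟨ +-identityˡ (β p) ⟩
  β p                ∎
  where
    γ : Coeffs _ _
    γ p = α p - β p
    γ-in-S : SupportedIn γ _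
    γ-in-S p Sp≡false = trans (cong₂ _-_ (α-in-S p Sp≡false) (β-in-S p Sp≡false)) refl
    margin-γ : ∀ l → margin γ l ≡ 0ℚ
    margin-γ l = trans (margin-- α β l) (trans (cong (_- margin β l) (same l)) (+-inverseʳ (margin β l)))
    γ≡0 : γ p ≡ 0ℚ
    γ≡0 = indep γ γ-in-S (sumFin-zero (margin-γ ∘ inj₁)) (margin-γ ∘ inj₁) (margin-γ ∘ inj₂) p

positive-zigzag : {λ′ ξ : Coeffs m n} → NonNeg λ′ → NonNeg ξ → (∀ l → margin λ′ l ≡ margin ξ l) →
                  ∀ {i₀ j} → 0ℚ < ξ (i₀ , j) → ∃[ i ] (0ℚ < λ′ (i , j) × ∃[ j′ ] 0ℚ < ξ (i , j′))
positive-zigzag {λ′ = λ′} {ξ} λ′-nonNeg ξ-nonNeg same {i₀} {j} 0<ξi₀j =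
  let i , 0<λ′ij = sumFin-pos⇒∃pos column-pos
      j′ , 0<ξij′ = sumFin-pos⇒∃pos (row-pos i 0<λ′ij)
  in i , 0<λ′ij , j′ , 0<ξij′
  where
    column-pos : 0ℚ < margin λ′ (inj₂ j)
    column-pos = subst (0ℚ <_) (sym (same (inj₂ j)))
                       (<-≤-trans 0<ξi₀j (≤-sumFin (λ i → ξ-nonNeg (i , j)) i₀))
    row-pos : ∀ i → 0ℚ < λ′ (i , j) → 0ℚ < margin ξ (inj₁ i)
    row-pos i 0<λ′ij = subst (0ℚ <_) (same (inj₁ i))
                             (<-≤-trans 0<λ′ij (≤-sumFin (λ j → λ′-nonNeg (i , j)) j))

module _ {A : Subset m n} {T : Subset m n → Set} (tri : IsTriangulation A T) where
  open IsTriangulation tri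

  -- β is in conv σ and conv τ, hence in conv (σ ∩ τ); by uniqueness of coefficients on σ,
  -- those coefficients are β itself, which is positive on all of σ.
  ⊆-of-interior-point : ∀ {σ τ} → T σ → T τ → ∀ {β} → NonNeg β → SupportedIn β σ → total β ≡ 1ℚ →
                        (∀ p → p ∈S σ → 0ℚ < β p) → InConv (combo β) τ → σ ⊆S τ
  ⊆-of-interior-point {σ} {τ} Tσ Tτ {β} β-nonNeg β-in-σ total-β≡1 β-pos β∈convτ p p∈σ =
    let β′ , _ , β′-in-σ∩τ , _ , same-combo = intersectProperly σ τ Tσ Tτ (combo β) β∈convσ β∈convτ
        β′-in-σ : SupportedIn β′ σ
        β′-in-σ p σp≡false = β′-in-σ∩τ p (cong (_∧ τ p) σp≡false)
        β≡β′ = unique-coefficients (affIndep σ Tσ) β-in-σ β′-in-σ (sym ∘ ≗ᵖ⇒margins same-combo)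
        0<β′p = subst (0ℚ <_) (β≡β′ p) (β-pos p p∈σ)
    in ∧-true⇒ʳ (¬-not (pos⇒≢0 0<β′p ∘ β′-in-σ∩τ p))
    where
      β∈convσ : InConv (combo β) σ
      β∈convσ = β , β-nonNeg , β-in-σ , total-β≡1 , (λ _ → refl) , (λ _ → refl)

-- The carrier of a perturbed barycentre

module PerturbedBarycentre {A : Subset m n} {T : Subset m n → Set} (tri : IsTriangulation A T)
                    {σ : Subset m n} (Tσ : T σ) {p₀ : Idx m n} (p₀∈σ : p₀ ∈S σ) where
  open IsTriangulation tri

  vertex? : ∀ i → Dec (EVertexOfG σ i)
  vertex? i = Fin.any? (λ j → σ (i , j) ≟ᵇ true)

  isVertex : Fin m → Bool
  isVertex i = does (vertex? i)

  P : Subset m n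
  P (i , j) = A (i , j) ∧ isVertex i

  σ̂ P̂ ν : Coeffs m n
  σ̂ p = 𝟙 (σ p)
  P̂ p = 𝟙 (P p)

  σ̂-nonNeg : NonNeg σ̂
  σ̂-nonNeg p = 𝟙-nonNeg (σ p)

  P̂-nonNeg : NonNeg P̂
  P̂-nonNeg p = 𝟙-nonNeg (P p)

  -- M bounds the margins of 𝟙P, and forest-rounding peels at most m·n leaves.
  M K : ℚ
  M = total P̂
  K = M *2^ (m ℕ.* n) + 1ℚ

  ν p = K * σ̂ p + P̂ p

  0≤M : 0ℚ ≤ M
  0≤M = sumFin-nonNeg (margin-nonNeg P̂-nonNeg ∘ inj₁)

  M*2^<K : M *2^ (m ℕ.* n) < K
  M*2^<K = subst (_< K) (+-identityʳ _) (+-monoʳ-< (M *2^ (m ℕ.* n)) 0<1)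

  0<K : 0ℚ < K
  0<K = ≤-<-trans (≤-trans 0≤M (≤*2^ 0≤M (m ℕ.* n))) M*2^<K

  ν-nonNeg : NonNeg ν
  ν-nonNeg p = +-nonNeg (*-nonNeg (<⇒≤ 0<K) (σ̂-nonNeg p)) (P̂-nonNeg p)

  ν-in-A : SupportedIn ν A
  ν-in-A p Ap≡false = begin
    K * 𝟙 (σ p) + 𝟙 (A p ∧ isVertex (proj₁ p))
      ≡⟨ cong₂ (λ s a → K * 𝟙 s + 𝟙 (a ∧ isVertex (proj₁ p)))
               (⊆⇒false (simplex⊆A σ Tσ) p Ap≡false) Ap≡false ⟩
    K * 0ℚ + 0ℚ ≡⟨ solve 1 (λ K → K :* con 0ℚ :+ con 0ℚ := con 0ℚ) refl K ⟩
    0ℚ ∎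

  0<ν-of-P : ∀ {p} → p ∈S P → 0ℚ < ν p
  0<ν-of-P {p} p∈P = <-≤-trans 0<1 (subst (_≤ ν p) (trans (+-identityˡ (P̂ p)) (cong 𝟙 p∈P))
                                            (+-monoˡ-≤ (P̂ p) (*-nonNeg (<⇒≤ 0<K) (σ̂-nonNeg p))))

  0<ν-of-σ : ∀ {p} → p ∈S σ → 0ℚ < ν p
  0<ν-of-σ {p} p∈σ = +-pos (subst (0ℚ <_) (sym Kσ̂p≡K) 0<K) (P̂-nonNeg p)
    where
      Kσ̂p≡K : K * σ̂ p ≡ K
      Kσ̂p≡K = trans (cong (λ b → K * 𝟙 b) p∈σ) (*-identityʳ K)

  0<total-ν : 0ℚ < total ν
  0<total-ν = <-≤-trans (0<ν-of-σ p₀∈σ) (entry≤total ν-nonNeg p₀)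

  σ̂-in-σ : SupportedIn σ̂ σ
  σ̂-in-σ p σp≡false = cong 𝟙 σp≡false

  0<total-σ̂ : 0ℚ < total σ̂
  0<total-σ̂ = <-≤-trans (subst (0ℚ <_) (cong 𝟙 (sym p₀∈σ)) 0<1) (entry≤total σ̂-nonNeg p₀)

  ξ : Coeffs m n
  ξ = normalise ν 0<total-ν

  ξ∈convA : InConv (combo ξ) A
  ξ∈convA = inConv-normalise ν 0<total-ν ν-nonNeg ν-in-A (λ _ → refl)

  vertex-of-ξ : ∀ {i j} → 0ℚ < ξ (i , j) → EVertexOfG σ i
  vertex-of-ξ {i} {j} 0<ξij with σ (i , j) ≟ᵇ true | P (i , j) ≟ᵇ true
  ... | yes σij | _       = j , σij
  ... | no σij≢ | no Pij≢ = contradiction (normalise-zero ν 0<total-ν ν≡0) (pos⇒≢0 0<ξij)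
    where
      ν≡0 : ν (i , j) ≡ 0ℚ
      ν≡0 = trans (cong₂ (λ s a → K * 𝟙 s + 𝟙 a) (¬-not σij≢) (¬-not Pij≢))
                  (solve 1 (λ K → K :* con 0ℚ :+ con 0ℚ := con 0ℚ) refl K)
  ... | no _    | yes Pij with vertex? i
  ...   | yes vertex-i = vertex-i
  ...   | no _         = contradiction (∧-true⇒ʳ {A (i , j)} Pij) λ ()

  module Carrier {τ} (Tτ : T τ) {λ′ : Coeffs m n} (λ′-nonNeg : NonNeg λ′)
                 (λ′-in-τ : SupportedIn λ′ τ) (margin-λ′ : ∀ l → margin λ′ l ≡ margin ξ l) where

    adjacent : (j : Fin n) → FAdjToVertexOf A j σ → FAdjToVertexOf τ j σ
    adjacent j (i₀ , vertex-i₀ , Ai₀j) =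
      let i , 0<λ′ij , j′ , 0<ξij′ = positive-zigzag λ′-nonNeg ξ-nonNeg margin-λ′ 0<ξi₀j
      in i , vertex-of-ξ 0<ξij′ , ¬-not (pos⇒≢0 0<λ′ij ∘ λ′-in-τ (i , j))
      where
        ξ-nonNeg = normalise-nonNeg ν 0<total-ν ν-nonNeg
        0<ξi₀j : 0ℚ < ξ (i₀ , j)
        0<ξi₀j = normalise-pos ν 0<total-ν (0<ν-of-P (cong₂ _∧_ Ai₀j (dec-true (vertex? i₀) vertex-i₀)))

    Nλ′ : Coeffs m n
    Nλ′ p = total ν * λ′ p

    scaled : ScaledMargins τ Nλ′ K M (margin σ̂)
    scaled = record
      { L-nonNeg    = *-NonNeg (<⇒≤ 0<total-ν) λ′-nonNeg
      ; L-in-S      = *-SupportedIn {c = total ν} λ′-in-τ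
      ; u-int       = margin-int (λ p → IsInt-𝟙 (σ p))
      ; error       = margin P̂
      ; error-bound = λ l → subst (_≤ M) (sym (0≤p⇒∣p∣≡p (margin-nonNeg P̂-nonNeg l)))
                                         (margin≤total P̂-nonNeg l)
      ; margin-L    = margin-Nλ′ }
      where
        margin-Nλ′ : ∀ l → margin Nλ′ l ≡ K * margin σ̂ l + margin P̂ l
        margin-Nλ′ l = begin
          margin Nλ′ l                            ≡⟨ margin-* (total ν) λ′ l ⟩
          total ν * margin λ′ l                   ≡⟨ cong (total ν *_) (margin-λ′ l) ⟩
          total ν * margin ξ l                    ≡⟨ total*margin-normalise ν 0<total-ν l ⟩
          margin ν l                              ≡⟨ margin-+ (λ p → K * σ̂ p) P̂ l ⟩
          margin (λ p → K * σ̂ p) l + margin P̂ l  ≡⟨ cong (_+ margin P̂ l) (margin-* K σ̂ l) ⟩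
          K * margin σ̂ l + margin P̂ l            ∎

    σ⊆τ : σ ⊆S τ
    σ⊆τ =
      let μ₀ , μ₀-nonNeg , μ₀-in-τ , margin-μ₀ =
            forest-rounding (m ℕ.* n) (count≤ τ) (affIndep τ Tτ) 0≤M M*2^<K scaled
      in ⊆-of-interior-point tri Tσ Tτ
           (normalise-nonNeg σ̂ 0<total-σ̂ σ̂-nonNeg) (normalise-in σ̂ 0<total-σ̂ σ̂-in-σ)
           (total-normalise σ̂ 0<total-σ̂)
           (λ p p∈σ → normalise-pos σ̂ 0<total-σ̂ (subst (0ℚ <_) (cong 𝟙 (sym p∈σ)) 0<1))
           (inConv-normalise σ̂ 0<total-σ̂ μ₀-nonNeg μ₀-in-τ margin-μ₀)

  carrier : ∃[ τ ] (T τ × σ ⊆S τ × ((j : Fin n) → FAdjToVertexOf A j σ → FAdjToVertexOf τ j σ))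
  carrier =
    let τ , Tτ , λ′ , λ′-nonNeg , λ′-in-τ , _ , same-combo = covers (combo ξ) ξ∈convA
        open Carrier Tτ λ′-nonNeg λ′-in-τ (≗ᵖ⇒margins {μ = λ′} {ν = ξ} same-combo)
    in τ , Tτ , σ⊆τ , adjacent

proposition6p2 : (m n : ℕ) (A : Subset m n) (T : Subset m n → Set) →
    IsTriangulation A T → (σ : Subset m n) → T σ →
    ∃[ τ ] (T τ × σ ⊆S τ ×
      ((j : Fin n) → FAdjToVertexOf A j σ → FAdjToVertexOf τ j σ))
proposition6p2 m n A T tri σ Tσ with nonempty? σ
... | inj₁ (p₀ , p₀∈σ) = PerturbedBarycentre.carrier tri Tσ p₀∈σ
... | inj₂ σ-empty     = σ , Tσ , (λ _ p∈σ → p∈σ) , no-vertex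
  where
    no-vertex : (j : Fin n) → FAdjToVertexOf A j σ → FAdjToVertexOf σ j σ
    no-vertex j (i , (j′ , σij′) , _) = contradiction (trans (sym σij′) (σ-empty (i , j′))) λ ()
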